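{- The formula $\forall x\,\forall g\,\forall h\,((\mathrm{Reif}(g,x)\land\mathrm{Reif}(h,x))\Rightarrow g\approx h)$ is derivable in $\mathrm{Z}_{st}$.
   Context: $\mathrm{Z}_{st}$ is intuitionistic Zermelo set theory with Strong Extensionality and Transitive Closure: equality axioms ($=$ reflexive, $x=x'\land x=y\Rightarrow x'=y$, $=$ compatible with $\in$ on both sides), the Strong Extensionality scheme $\forall a\forall b(R(a,b)\land\forall x\forall x'\forall y(x'\in x\land R(x,y)\Rightarrow\exists y'(y'\in y\land R(x',y')))\land\forall y\forall y'\forall x(y'\in y\land R(x,y)\Rightarrow\exists x'(x'\in x\land R(x',y')))\Rightarrow a=b)$ for every formula $R$ with parameters, Pairing, Union, Powerset, Restricted Comprehension, Infinity, and Transitive Closure. Set-theoretic notations below are used as definitional abbreviations. Notation: $\langle a,b\rangle=\{\{a\},\{a,b\}\}$. A graph is a set all of whose elements are ordered pairs ($\mathrm{Graph}(A)$); $\mathrm{Car}(A)=\{x\in\bigcup\bigcup A\mid\exists y\,(\langle x,y\rangle\in A\lor\langle y,x\rangle\in A)\}$. A function $\phi$ is a set of ordered pairs with $\langle x,y\rangle,\langle x,y'\rangle\in\phi\Rightarrow y=y'$; $\mathrm{Dom}(\phi)$, $\mathrm{Cod}(\phi)$ are its sets of first and second components; $\phi(i)$ is the $y$ with $\langle i,y\rangle\in\phi$. $\mathrm{Collapse}(A,\phi)$ means: $A$ is a graph, $\phi$ is a function, $\mathrm{Dom}(\phi)=\mathrm{Car}(A)$, and for every $i\in\mathrm{Dom}(\phi)$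 and every $x$: $x\in\phi(i)$ iff there is $j\in\mathrm{Dom}(\phi)$ with $\langle j,i\rangle\in A$ and $x=\phi(j)$. $\hat\phi_A(i)=\{y\in\mathrm{Cod}(\phi)\mid\exists j\,(\langle j,i\rangle\in A\land\langle j,y\rangle\in\phi)\}$. $\mathrm{Reif}(g,x)\equiv\exists A\exists a\exists\phi\,(g=\langle A,a\rangle\land\mathrm{Collapse}(A,\phi)\land x=\hat\phi_A(a))$. Bisimilarity: $g\approx g'$ is the formula $\exists A\exists a\exists B\exists b\exists r\,(\mathrm{Graph}(A)\land\mathrm{Graph}(B)\land g=\langle A,a\rangle\land g'=\langle B,b\rangle\land\langle a,b\rangle\in r\land\forall x\forall x'\forall y((\langle x',x\rangle\in A\land\langle x,y\rangle\in r)\Rightarrow\exists y'(\langle y',y\rangle\in B\land\langle x',y'\rangle\in r))\land\forall y\forall y'\forall x((\langle y',y\rangle\in B\land\langle x,y\rangle\in r)\Rightarrow\exists x'(\langle x',x\rangle\in A\land\langle x',y'\rangle\in r)))$. -}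

module Defs where

open import Data.Nat using (ℕ; zero; suc; _+_; _∸_)
open import Data.List using (List; []; _∷_; map)
open import Data.List.Membership.Propositional using (_∈_)

-- Syntax of first-order logic in the language {∈, =}.
-- Terms are variables only (de Bruijn indices).

infix  9 _∈̇_ _≐_
infixr 6 _∧̇_
infixr 5 _∨̇_
infixr 4 _⇒̇_

data Fm : Set where
  ⊥̇   : Fm
  _∈̇_ : ℕ → ℕ → Fm
  _≐_  : ℕ → ℕ → Fm
  _∧̇_ : Fm → Fm → Fm
  _∨̇_ : Fm → Fm → Fm
  _⇒̇_ : Fm → Fm → Fm
  ∀̇    : Fm → Fm
  ∃̇    : Fm → Fm

ext : (ℕ → ℕ) → ℕ → ℕ
ext ρ zero    = zero
ext ρ (suc n) = suc (ρ n)

rename : (ℕ → ℕ) → Fm → Fm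
rename ρ ⊥̇        = ⊥̇
rename ρ (x ∈̇ y)  = ρ x ∈̇ ρ y
rename ρ (x ≐ y)  = ρ x ≐ ρ y
rename ρ (φ ∧̇ ψ) = rename ρ φ ∧̇ rename ρ ψ
rename ρ (φ ∨̇ ψ) = rename ρ φ ∨̇ rename ρ ψ
rename ρ (φ ⇒̇ ψ) = rename ρ φ ⇒̇ rename ρ ψ
rename ρ (∀̇ φ)    = ∀̇ (rename (ext ρ) φ)
rename ρ (∃̇ φ)    = ∃̇ (rename (ext ρ) φ)

shift : Fm → Fm
shift = rename suc

inst₀ : ℕ → ℕ → ℕ
inst₀ t zero    = t
inst₀ t (suc n) = n

inst : ℕ → Fm → Fm
inst t = rename (inst₀ t)

-- A builder takes the current binder depth d;
-- bound variables are referred to by *levels* (the depth at which they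
-- were bound), converted to de Bruijn index d ∸ suc level.  A free
-- variable n of an embedded formula (scheme parameter) has index n + d.

B : Set
B = ℕ → Fm

ix : ℕ → ℕ → ℕ
ix d l = d ∸ suc l

infix  9 _∈'_ _≐'_
infixr 6 _∧'_
infixr 5 _∨'_
infixr 4 _⇒'_
infix  3 _⇔'_

_∈'_ : ℕ → ℕ → B
(x ∈' y) d = ix d x ∈̇ ix d y

_≐'_ : ℕ → ℕ → B
(x ≐' y) d = ix d x ≐ ix d y

_∧'_ _∨'_ _⇒'_ _⇔'_ : B → B → B
(p ∧' q) d = p d ∧̇ q d
(p ∨' q) d = p d ∨̇ q d
(p ⇒' q) d = p d ⇒̇ q d
(p ⇔' q) d = (p d ⇒̇ q d) ∧̇ (q d ⇒̇ p d)

⊥' : B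
⊥' d = ⊥̇

¬' : B → B
¬' p = p ⇒' ⊥'

All Ex : (ℕ → B) → B
All f d = ∀̇ (f d (suc d))
Ex  f d = ∃̇ (f d (suc d))

plug₀ : ℕ → ℕ → ℕ → ℕ → ℕ
plug₀ d u v zero          = ix d u
plug₀ d u v (suc zero)    = ix d v
plug₀ d u v (suc (suc n)) = n + d

plug2 : Fm → ℕ → ℕ → B
plug2 R u v d = rename (plug₀ d u v) R

EqRefl EqEuc EqMemL EqMemR : B
EqRefl = All λ x → x ≐' x
EqEuc  = All λ x → All λ x' → All λ y → (x ≐' x' ∧' x ≐' y) ⇒' x' ≐' y
EqMemL = All λ x → All λ x' → All λ y → (x ≐' x' ∧' x ∈' y) ⇒' x' ∈' y
EqMemR = All λ x → All λ y → All λ y' → (y ≐' y' ∧' x ∈' y) ⇒' x ∈' y'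

-- Strong Extensionality, instance for R (R(a,b): variable 0 = a, 1 = b,
-- further free variables are parameters)
StrExt : Fm → B
StrExt R' = All λ a → All λ b →
  (  R a b
  ∧' (All λ x → All λ x' → All λ y →
        (x' ∈' x ∧' R x y) ⇒' (Ex λ y' → y' ∈' y ∧' R x' y'))
  ∧' (All λ y → All λ y' → All λ x →
        (y' ∈' y ∧' R x y) ⇒' (Ex λ x' → x' ∈' x ∧' R x' y')))
  ⇒' a ≐' b
  where R = plug2 R'

Pairing Union Power Infinity TransClos : B
Pairing = All λ a → All λ b → Ex λ c → All λ x → x ∈' c ⇔' (x ≐' a ∨' x ≐' b)
Union = All λ a → Ex λ u → All λ x → x ∈' u ⇔' (Ex λ y → y ∈' a ∧' x ∈' y)
Power = All λ a → Ex λ p → All λ z → z ∈' p ⇔' (All λ w → w ∈' z ⇒' w ∈' a)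
Infinity = Ex λ w →
  (Ex λ e → e ∈' w ∧' (All λ z → ¬' (z ∈' e)))
  ∧' (All λ y → y ∈' w ⇒'
        (Ex λ s → s ∈' w ∧' (All λ z → z ∈' s ⇔' (z ∈' y ∨' z ≐' y))))
TransClos = All λ a → Ex λ t →
  (All λ x → x ∈' a ⇒' x ∈' t)
  ∧' (All λ y → y ∈' t ⇒' (All λ z → z ∈' y ⇒' z ∈' t))

-- Restricted Comprehension, instance for φ (variable 0 = x, 1 = a,
-- further free variables are parameters; c does not occur in φ)
Sep : Fm → B
Sep φ = All λ a → Ex λ c → All λ x → x ∈' c ⇔' (x ∈' a ∧' plug2 φ x a)

data ZstAx : Fm → Set where
  ax-refl   : ZstAx (EqRefl 0)
  ax-euc    : ZstAx (EqEuc 0)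
  ax-memL   : ZstAx (EqMemL 0)
  ax-memR   : ZstAx (EqMemR 0)
  ax-strext : (R : Fm) → ZstAx (StrExt R 0)
  ax-pair   : ZstAx (Pairing 0)
  ax-union  : ZstAx (Union 0)
  ax-power  : ZstAx (Power 0)
  ax-sep    : (φ : Fm) → ZstAx (Sep φ 0)
  ax-inf    : ZstAx (Infinity 0)
  ax-tc     : ZstAx (TransClos 0)

infix 2 _⊢_

data _⊢_ (Γ : List Fm) : Fm → Set where
  hyp  : ∀ {φ} → φ ∈ Γ → Γ ⊢ φ
  axm  : ∀ {φ} → ZstAx φ → Γ ⊢ φ
  ⊥E   : ∀ {φ} → Γ ⊢ ⊥̇ → Γ ⊢ φ
  ∧I   : ∀ {φ ψ} → Γ ⊢ φ → Γ ⊢ ψ → Γ ⊢ φ ∧̇ ψ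
  ∧E₁  : ∀ {φ ψ} → Γ ⊢ φ ∧̇ ψ → Γ ⊢ φ
  ∧E₂  : ∀ {φ ψ} → Γ ⊢ φ ∧̇ ψ → Γ ⊢ ψ
  ∨I₁  : ∀ {φ ψ} → Γ ⊢ φ → Γ ⊢ φ ∨̇ ψ
  ∨I₂  : ∀ {φ ψ} → Γ ⊢ ψ → Γ ⊢ φ ∨̇ ψ
  ∨E   : ∀ {φ ψ χ} → Γ ⊢ φ ∨̇ ψ → (φ ∷ Γ) ⊢ χ → (ψ ∷ Γ) ⊢ χ → Γ ⊢ χ
  ⇒I   : ∀ {φ ψ} → (φ ∷ Γ) ⊢ ψ → Γ ⊢ φ ⇒̇ ψ
  ⇒E   : ∀ {φ ψ} → Γ ⊢ φ ⇒̇ ψ → Γ ⊢ φ → Γ ⊢ ψ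
  ∀I   : ∀ {φ} → map shift Γ ⊢ φ → Γ ⊢ ∀̇ φ
  ∀E   : ∀ {φ} → Γ ⊢ ∀̇ φ → (t : ℕ) → Γ ⊢ inst t φ
  ∃I   : ∀ {φ} → (t : ℕ) → Γ ⊢ inst t φ → Γ ⊢ ∃̇ φ
  ∃E   : ∀ {φ ψ} → Γ ⊢ ∃̇ φ → (φ ∷ map shift Γ) ⊢ shift ψ → Γ ⊢ ψ

Sing : ℕ → ℕ → B
Sing s a = All λ z → z ∈' s ⇔' z ≐' a

Pr : ℕ → ℕ → ℕ → B
Pr s a b = All λ z → z ∈' s ⇔' (z ≐' a ∨' z ≐' b)

OP : ℕ → ℕ → ℕ → B
OP p a b = Ex λ s → Ex λ t → Sing s a ∧' Pr t a b ∧'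
  (All λ z → z ∈' p ⇔' (z ≐' s ∨' z ≐' t))

OPin : ℕ → ℕ → ℕ → B
OPin a b A = Ex λ p → OP p a b ∧' p ∈' A

InUU : ℕ → ℕ → B
InUU x A = Ex λ u → Ex λ v → x ∈' v ∧' v ∈' u ∧' u ∈' A

Graph : ℕ → B
Graph A = All λ p → p ∈' A ⇒' (Ex λ x → Ex λ y → OP p x y)

InCar : ℕ → ℕ → B
InCar x A = InUU x A ∧' (Ex λ y → OPin x y A ∨' OPin y x A)

Fun : ℕ → B
Fun f = Graph f ∧' (All λ x → All λ y → All λ y' →
  (OPin x y f ∧' OPin x y' f) ⇒' y ≐' y')

InDom InCod : ℕ → ℕ → B
InDom x f = InUU x f ∧' (Ex λ y → OPin x y f)
InCod y f = InUU y f ∧' (Ex λ x → OPin x y f)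

InApp : ℕ → ℕ → ℕ → B
InApp x f i = Ex λ y → OPin i y f ∧' x ∈' y

EqApp : ℕ → ℕ → ℕ → B
EqApp x f j = OPin j x f

Collapse : ℕ → ℕ → B
Collapse A f = Graph A ∧' Fun f ∧'
  (All λ x → InDom x f ⇔' InCar x A) ∧'
  (All λ i → InDom i f ⇒' (All λ x →
     InApp x f i ⇔' (Ex λ j → InDom j f ∧' OPin j i A ∧' EqApp x f j)))

IsHat : ℕ → ℕ → ℕ → ℕ → B
IsHat x f A a = All λ y → y ∈' x ⇔'
  (InCod y f ∧' (Ex λ j → OPin j a A ∧' OPin j y f))

Reif : ℕ → ℕ → B
Reif g x = Ex λ A → Ex λ a → Ex λ f →
  OP g A a ∧' Collapse A f ∧' IsHat x f A a

Bisim : ℕ → ℕ → B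
Bisim g g' = Ex λ A → Ex λ a → Ex λ B' → Ex λ b → Ex λ r →
  Graph A ∧' Graph B' ∧' OP g A a ∧' OP g' B' b ∧' OPin a b r ∧'
  (All λ x → All λ x' → All λ y →
     (OPin x' x A ∧' OPin x y r) ⇒' (Ex λ y' → OPin y' y B' ∧' OPin x' y' r)) ∧'
  (All λ y → All λ y' → All λ x →
     (OPin y' y B' ∧' OPin x y r) ⇒' (Ex λ x' → OPin x' x A ∧' OPin x' y' r))

ReifUnique : Fm
ReifUnique = (All λ x → All λ g → All λ h →
  (Reif g x ∧' Reif h x) ⇒' Bisim g h) 0

-- Let g and h reify the same x through collapses (A, a, φ) and (B, b, ψ).  The relation r
-- relating a to b, and i to j whenever φ(i) = ψ(j), is a bisimulation.  If x' is an
-- A-predecessor of x and φ(x) = ψ(y), then φ(x') ∈ φ(x) = ψ(y), so by the collapse equation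
-- for ψ it equals ψ(y') for some B-predecessor y' of y; at the root, φ(x') ∈ φ̂_A(a) = x = ψ̂_B(b)
-- does the same job.  The set r is cut out of 𝒫𝒫(T) by Restricted Comprehension, where T is
-- the transitive closure of {g, h}.
module Submission where

open import Data.Nat using (ℕ; zero; suc)
open import Data.List using (List; []; _∷_)
open import Data.List.Relation.Unary.Any using (here)
open import Data.List.Relation.Binary.Subset.Propositional using (_⊆_)
open import Data.List.Relation.Binary.Subset.Propositional.Properties using (map⁺; ∷⁺ʳ; xs⊆x∷xs)
open import Relation.Binary.PropositionalEquality using (refl)
open import Defs

weaken : ∀ {Γ Δ φ} → Γ ⊆ Δ → Γ ⊢ φ → Δ ⊢ φ
weaken s (hyp m)    = hyp (s m)
weaken s (axm a)    = axm a
weaken s (⊥E d)     = ⊥E (weaken s d)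
weaken s (∧I d e)   = ∧I (weaken s d) (weaken s e)
weaken s (∧E₁ d)    = ∧E₁ (weaken s d)
weaken s (∧E₂ d)    = ∧E₂ (weaken s d)
weaken s (∨I₁ d)    = ∨I₁ (weaken s d)
weaken s (∨I₂ d)    = ∨I₂ (weaken s d)
weaken s (∨E d e f) = ∨E (weaken s d) (weaken (∷⁺ʳ _ s) e) (weaken (∷⁺ʳ _ s) f)
weaken s (⇒I d)     = ⇒I (weaken (∷⁺ʳ _ s) d)
weaken s (⇒E d e)   = ⇒E (weaken s d) (weaken s e)
weaken s (∀I d)     = ∀I (weaken (map⁺ shift s) d)
weaken s (∀E d t)   = ∀E (weaken s d) t
weaken s (∃I t d)   = ∃I t (weaken s d)
weaken s (∃E d e)   = ∃E (weaken s d) (weaken (∷⁺ʳ _ (map⁺ shift s)) e)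

weaken-[] : ∀ {Γ φ} → [] ⊢ φ → Γ ⊢ φ
weaken-[] = weaken (λ ())

weaken-∷ : ∀ {Γ φ ψ} → Γ ⊢ φ → (ψ ∷ Γ) ⊢ φ
weaken-∷ {Γ} {ψ = ψ} = weaken (xs⊆x∷xs Γ ψ)

nth : List Fm → ℕ → Fm
nth []      n       = ⊥̇ ⇒̇ ⊥̇
nth (φ ∷ Γ) zero    = φ
nth (φ ∷ Γ) (suc n) = nth Γ n

-- # n is the n-th hypothesis, counting from the most recent assumption.
#_ : ∀ {Γ} n → Γ ⊢ nth Γ n
#_ {[]}    n       = ⇒I (hyp (here refl))
#_ {φ ∷ Γ} zero    = hyp (here refl)
#_ {φ ∷ Γ} (suc n) = weaken-∷ (# n)

infixl 5 _⊢·_ _⊢$_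

_⊢·_ : ∀ {Γ φ} → Γ ⊢ ∀̇ φ → ∀ t → Γ ⊢ inst t φ
_⊢·_ = ∀E

_⊢$_ : ∀ {Γ φ ψ} → Γ ⊢ φ ⇒̇ ψ → Γ ⊢ φ → Γ ⊢ ψ
_⊢$_ = ⇒E

have : ∀ {Γ φ ψ} → Γ ⊢ φ → (φ ∷ Γ) ⊢ ψ → Γ ⊢ ψ
have d k = ⇒E (⇒I k) d

∨-cases : ∀ {Γ φ ψ χ} → Γ ⊢ φ ∨̇ ψ
        → ((φ ∷ Γ) ⊢ φ → (φ ∷ Γ) ⊢ χ) → ((ψ ∷ Γ) ⊢ ψ → (ψ ∷ Γ) ⊢ χ) → Γ ⊢ χ
∨-cases d k₁ k₂ = ∨E d (k₁ (# 0)) (k₂ (# 0))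

⇔E₁ : ∀ {Γ φ ψ} → Γ ⊢ (φ ⇒̇ ψ) ∧̇ (ψ ⇒̇ φ) → Γ ⊢ φ → Γ ⊢ ψ
⇔E₁ p = ⇒E (∧E₁ p)

⇔E₂ : ∀ {Γ φ ψ} → Γ ⊢ (φ ⇒̇ ψ) ∧̇ (ψ ⇒̇ φ) → Γ ⊢ ψ → Γ ⊢ φ
⇔E₂ p = ⇒E (∧E₂ p)

Bⁿ : ℕ → Set
Bⁿ zero    = B
Bⁿ (suc n) = ℕ → Bⁿ n

∀ⁿ : (n : ℕ) → Bⁿ n → Fm
∀ⁿ n f = close n f 0
  where
  close : (n : ℕ) → Bⁿ n → B
  close zero    p = p
  close (suc n) f = All λ a → close n (f a)

-- φ · t instantiates the outermost quantifier of φ by the variable t, so that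
-- ∀ⁿ n f · t₁ · … · tₙ is the formula f at the free variables t₁ … tₙ.
infixl 8 _·_

_·_ : Fm → ℕ → Fm
∀̇ φ · t = inst t φ
φ   · t = φ

≐-refl : ∀ {Γ} u → Γ ⊢ u ≐ u
≐-refl u = axm ax-refl ⊢· u

≐-sym : ∀ {Γ u v} → Γ ⊢ u ≐ v → Γ ⊢ v ≐ u
≐-sym {u = u} {v} p = axm ax-euc ⊢· u ⊢· v ⊢· u ⊢$ ∧I p (≐-refl u)

≐-trans : ∀ {Γ u v w} → Γ ⊢ u ≐ v → Γ ⊢ v ≐ w → Γ ⊢ u ≐ w
≐-trans {u = u} {v} {w} p q = axm ax-euc ⊢· v ⊢· u ⊢· w ⊢$ ∧I (≐-sym p) q

∈-substˡ : ∀ {Γ u u' y} → Γ ⊢ u ≐ u' → Γ ⊢ u ∈̇ y → Γ ⊢ u' ∈̇ y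
∈-substˡ {u = u} {u'} {y} p q = axm ax-memL ⊢· u ⊢· u' ⊢· y ⊢$ ∧I p q

∈-substʳ : ∀ {Γ x y y'} → Γ ⊢ y ≐ y' → Γ ⊢ x ∈̇ y → Γ ⊢ x ∈̇ y'
∈-substʳ {x = x} {y} {y'} p q = axm ax-memR ⊢· x ⊢· y ⊢· y' ⊢$ ∧I p q

∈-Sing⁺ : ∀ {Γ s x} z → Γ ⊢ ∀ⁿ 2 Sing · s · x → Γ ⊢ z ≐ x → Γ ⊢ z ∈̇ s
∈-Sing⁺ z p = ⇔E₂ (p ⊢· z)

∈-Sing⁻ : ∀ {Γ s x} z → Γ ⊢ ∀ⁿ 2 Sing · s · x → Γ ⊢ z ∈̇ s → Γ ⊢ z ≐ x
∈-Sing⁻ z p = ⇔E₁ (p ⊢· z)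

∈-Pr⁺ˡ : ∀ {Γ t a b} z → Γ ⊢ ∀ⁿ 3 Pr · t · a · b → Γ ⊢ z ≐ a → Γ ⊢ z ∈̇ t
∈-Pr⁺ˡ z p q = ⇔E₂ (p ⊢· z) (∨I₁ q)

∈-Pr⁺ʳ : ∀ {Γ t a b} z → Γ ⊢ ∀ⁿ 3 Pr · t · a · b → Γ ⊢ z ≐ b → Γ ⊢ z ∈̇ t
∈-Pr⁺ʳ z p q = ⇔E₂ (p ⊢· z) (∨I₂ q)

∈-Pr⁻ : ∀ {Γ t a b} z → Γ ⊢ ∀ⁿ 3 Pr · t · a · b → Γ ⊢ z ∈̇ t → Γ ⊢ z ≐ a ∨̇ z ≐ b
∈-Pr⁻ z p = ⇔E₁ (p ⊢· z)

Kuratowski-injective : ∀ {Γ p s t s' t' x y i j}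
  → Γ ⊢ ∀ⁿ 2 Sing · s · x → Γ ⊢ ∀ⁿ 3 Pr · t · x · y → Γ ⊢ ∀ⁿ 3 Pr · p · s · t
  → Γ ⊢ ∀ⁿ 2 Sing · s' · i → Γ ⊢ ∀ⁿ 3 Pr · t' · i · j → Γ ⊢ ∀ⁿ 3 Pr · p · s' · t'
  → Γ ⊢ x ≐ i ∧̇ y ≐ j
Kuratowski-injective {Γ} {s = s} {t} {s'} {t'} {x} {y} {i} {j} Sx Pxy Pst Si Pij Ps't' = ∧I x≐i y≐j
  where
  x≐i : Γ ⊢ x ≐ i
  x≐i = ∨-cases (∈-Pr⁻ s Ps't' (∈-Pr⁺ˡ s Pst (≐-refl s)))
    (λ e → ≐-sym (∈-Sing⁻ i (weaken-∷ Sx) (∈-substʳ (≐-sym e) (∈-Sing⁺ i (weaken-∷ Si) (≐-refl i)))))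
    (λ e → ≐-sym (∈-Sing⁻ i (weaken-∷ Sx) (∈-substʳ (≐-sym e) (∈-Pr⁺ˡ i (weaken-∷ Pij) (≐-refl i)))))
  j≐x∨j≐y : Γ ⊢ j ≐ x ∨̇ j ≐ y
  j≐x∨j≐y = ∨-cases (∈-Pr⁻ t' Pst (∈-Pr⁺ʳ t' Ps't' (≐-refl t')))
    (λ e → ∨I₁ (∈-Sing⁻ j (weaken-∷ Sx) (∈-substʳ e (∈-Pr⁺ʳ j (weaken-∷ Pij) (≐-refl j)))))
    (λ e → ∈-Pr⁻ j (weaken-∷ Pxy) (∈-substʳ e (∈-Pr⁺ʳ j (weaken-∷ Pij) (≐-refl j))))
  y≐i∨y≐j : Γ ⊢ y ≐ i ∨̇ y ≐ j
  y≐i∨y≐j = ∨-cases (∈-Pr⁻ t Ps't' (∈-Pr⁺ʳ t Pst (≐-refl t)))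
    (λ e → ∨I₁ (∈-Sing⁻ y (weaken-∷ Si) (∈-substʳ e (∈-Pr⁺ʳ y (weaken-∷ Pxy) (≐-refl y)))))
    (λ e → ∈-Pr⁻ y (weaken-∷ Pij) (∈-substʳ e (∈-Pr⁺ʳ y (weaken-∷ Pxy) (≐-refl y))))
  y≐j : Γ ⊢ y ≐ j
  y≐j = ∨-cases y≐i∨y≐j
    (λ y≐i → ∨-cases (weaken-∷ j≐x∨j≐y)
      (λ j≐x → ≐-trans (weaken-∷ y≐i) (≐-trans (≐-sym (weaken-∷ (weaken-∷ x≐i))) (≐-sym j≐x)))
      ≐-sym)
    (λ y≐j → y≐j)

-- A rule about formulas with free variables is derived as a closed universal statement and
-- then instantiated: under the binders of the empty context no renaming lemmas are needed.
OP-injective : ∀ {Γ p x y i j} → Γ ⊢ ∀ⁿ 3 OP · p · x · y → Γ ⊢ ∀ⁿ 3 OP · p · i · j → Γ ⊢ x ≐ i ∧̇ y ≐ j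
OP-injective {p = p} {x} {y} {i} {j} d e = weaken-[] closed ⊢· p ⊢· x ⊢· y ⊢· i ⊢· j ⊢$ d ⊢$ e
  where
  closed : [] ⊢ ∀ⁿ 5 λ p x y i j → OP p x y ⇒' OP p i j ⇒' x ≐' i ∧' y ≐' j
  closed = ∀I (∀I (∀I (∀I (∀I (⇒I (⇒I
    (∃E (# 1) (∃E (# 0) (∃E (# 2) (∃E (# 0)
    (Kuratowski-injective (∧E₁ (# 2)) (∧E₁ (∧E₂ (# 2))) (∧E₂ (∧E₂ (# 2)))
                         (∧E₁ (# 0)) (∧E₁ (∧E₂ (# 0))) (∧E₂ (∧E₂ (# 0))))))))))))))

Sing-resp-≐ : ∀ {Γ s u u'} → Γ ⊢ ∀ⁿ 2 Sing · s · u → Γ ⊢ u ≐ u' → Γ ⊢ ∀ⁿ 2 Sing · s · u'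
Sing-resp-≐ {s = s} {u} {u'} d e = weaken-[] closed ⊢· s ⊢· u ⊢· u' ⊢$ d ⊢$ e
  where
  closed : [] ⊢ ∀ⁿ 3 λ s u u' → Sing s u ⇒' u ≐' u' ⇒' Sing s u'
  closed = ∀I (∀I (∀I (⇒I (⇒I (∀I (∧I
    (⇒I (≐-trans (∈-Sing⁻ 0 (# 2) (# 0)) (# 1)))
    (⇒I (∈-Sing⁺ 0 (# 2) (≐-trans (# 0) (≐-sym (# 1)))))))))))

Pr-resp-≐ : ∀ {Γ t a b a' b'} → Γ ⊢ ∀ⁿ 3 Pr · t · a · b → Γ ⊢ a ≐ a' → Γ ⊢ b ≐ b'
  → Γ ⊢ ∀ⁿ 3 Pr · t · a' · b'
Pr-resp-≐ {t = t} {a} {b} {a'} {b'} d e₁ e₂ = weaken-[] closed ⊢· t ⊢· a ⊢· b ⊢· a' ⊢· b' ⊢$ d ⊢$ e₁ ⊢$ e₂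
  where
  closed : [] ⊢ ∀ⁿ 5 λ t a b a' b' → Pr t a b ⇒' a ≐' a' ⇒' b ≐' b' ⇒' Pr t a' b'
  closed = ∀I (∀I (∀I (∀I (∀I (⇒I (⇒I (⇒I (∀I (∧I
    (⇒I (∨-cases (∈-Pr⁻ 0 (# 3) (# 0))
      (λ e → ∨I₁ (≐-trans e (weaken-∷ (# 2))))
      (λ e → ∨I₂ (≐-trans e (weaken-∷ (# 1))))))
    (⇒I (∨-cases (# 0)
      (λ e → ∈-Pr⁺ˡ 0 (weaken-∷ (# 3)) (≐-trans e (≐-sym (weaken-∷ (# 2)))))
      (λ e → ∈-Pr⁺ʳ 0 (weaken-∷ (# 3)) (≐-trans e (≐-sym (weaken-∷ (# 1))))))))))))))))

OPin-resp-≐ : ∀ {Γ u v u' v' A} → Γ ⊢ ∀ⁿ 3 OPin · u · v · A → Γ ⊢ u ≐ u' → Γ ⊢ v ≐ v'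
  → Γ ⊢ ∀ⁿ 3 OPin · u' · v' · A
OPin-resp-≐ {u = u} {v} {u'} {v'} {A} d e₁ e₂ =
  weaken-[] closed ⊢· u ⊢· v ⊢· u' ⊢· v' ⊢· A ⊢$ d ⊢$ e₁ ⊢$ e₂
  where
  closed : [] ⊢ ∀ⁿ 5 λ u v u' v' A → OPin u v A ⇒' u ≐' u' ⇒' v ≐' v' ⇒' OPin u' v' A
  closed = ∀I (∀I (∀I (∀I (∀I (⇒I (⇒I (⇒I
    (∃E (# 2) (∃E (∧E₁ (# 0)) (∃E (# 0)
    (∃I 2 (∧I (∃I 1 (∃I 0 (∧I (Sing-resp-≐ (∧E₁ (# 0)) (# 4))
                                (∧I (Pr-resp-≐ (∧E₁ (∧E₂ (# 0))) (# 4) (# 3)) (∧E₂ (∧E₂ (# 0)))))))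
              (∧E₂ (# 2))))))))))))))

OPin⇒InUUˡ : ∀ {Γ u v A} → Γ ⊢ ∀ⁿ 3 OPin · u · v · A → Γ ⊢ ∀ⁿ 2 InUU · u · A
OPin⇒InUUˡ {u = u} {v} {A} d = weaken-[] closed ⊢· u ⊢· v ⊢· A ⊢$ d
  where
  closed : [] ⊢ ∀ⁿ 3 λ u v A → OPin u v A ⇒' InUU u A
  closed = ∀I (∀I (∀I (⇒I (∃E (# 0) (∃E (∧E₁ (# 0)) (∃E (# 0)
    (∃I 2 (∃I 1 (∧I (∈-Sing⁺ 5 (∧E₁ (# 0)) (≐-refl 5))
                     (∧I (∈-Pr⁺ˡ 1 (∧E₂ (∧E₂ (# 0))) (≐-refl 1)) (∧E₂ (# 2))))))))))))

OPin⇒InUUʳ : ∀ {Γ u v A} → Γ ⊢ ∀ⁿ 3 OPin · u · v · A → Γ ⊢ ∀ⁿ 2 InUU · v · A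
OPin⇒InUUʳ {u = u} {v} {A} d = weaken-[] closed ⊢· u ⊢· v ⊢· A ⊢$ d
  where
  closed : [] ⊢ ∀ⁿ 3 λ u v A → OPin u v A ⇒' InUU v A
  closed = ∀I (∀I (∀I (⇒I (∃E (# 0) (∃E (∧E₁ (# 0)) (∃E (# 0)
    (∃I 2 (∃I 0 (∧I (∈-Pr⁺ʳ 4 (∧E₁ (∧E₂ (# 0))) (≐-refl 4))
                     (∧I (∈-Pr⁺ʳ 0 (∧E₂ (∧E₂ (# 0))) (≐-refl 0)) (∧E₂ (# 2))))))))))))

Pr-diagonal⇒Sing : ∀ {Γ s u} → Γ ⊢ ∀ⁿ 3 Pr · s · u · u → Γ ⊢ ∀ⁿ 2 Sing · s · u
Pr-diagonal⇒Sing {s = s} {u} d = weaken-[] closed ⊢· s ⊢· u ⊢$ d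
  where
  closed : [] ⊢ ∀ⁿ 2 λ s u → Pr s u u ⇒' Sing s u
  closed = ∀I (∀I (⇒I (∀I (∧I
    (⇒I (∨-cases (∈-Pr⁻ 0 (# 1) (# 0)) (λ e → e) (λ e → e)))
    (⇒I (∈-Pr⁺ˡ 0 (# 1) (# 0)))))))

OP-exists : ∀ {Γ} u v → Γ ⊢ ∀ⁿ 2 (λ u v → Ex λ p → OP p u v) · u · v
OP-exists u v = weaken-[] closed ⊢· u ⊢· v
  where
  closed : [] ⊢ ∀ⁿ 2 λ u v → Ex λ p → OP p u v
  closed = ∀I (∀I
    (∃E (axm ax-pair ⊢· 1 ⊢· 1) (∃E (axm ax-pair ⊢· 2 ⊢· 1) (∃E (axm ax-pair ⊢· 1 ⊢· 0)
    (∃I 0 (∃I 2 (∃I 1 (∧I (Pr-diagonal⇒Sing (# 2)) (∧I (# 1) (# 0))))))))))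

Transitive : ℕ → B
Transitive T = All λ y → y ∈' T ⇒' (All λ z → z ∈' y ⇒' z ∈' T)

IsPowerset : ℕ → ℕ → B
IsPowerset P X = All λ z → z ∈' P ⇔' (All λ w → w ∈' z ⇒' w ∈' X)

Transitive-∈ : ∀ {Γ T y z} → Γ ⊢ ∀ⁿ 1 Transitive · T → Γ ⊢ y ∈̇ T → Γ ⊢ z ∈̇ y → Γ ⊢ z ∈̇ T
Transitive-∈ {y = y} {z} tr p q = tr ⊢· y ⊢$ p ⊢· z ⊢$ q

Transitive-OP : ∀ {Γ T p u v} → Γ ⊢ ∀ⁿ 1 Transitive · T → Γ ⊢ p ∈̇ T → Γ ⊢ ∀ⁿ 3 OP · p · u · v
  → Γ ⊢ u ∈̇ T ∧̇ v ∈̇ T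
Transitive-OP {T = T} {p} {u} {v} tr p∈T d = weaken-[] closed ⊢· T ⊢· p ⊢· u ⊢· v ⊢$ tr ⊢$ p∈T ⊢$ d
  where
  closed : [] ⊢ ∀ⁿ 4 λ T p u v → Transitive T ⇒' p ∈' T ⇒' OP p u v ⇒' u ∈' T ∧' v ∈' T
  closed = ∀I (∀I (∀I (∀I (⇒I (⇒I (⇒I (∃E (# 0) (∃E (# 0) (∧I
    (Transitive-∈ (# 4) (Transitive-∈ (# 4) (# 3) (∈-Pr⁺ˡ 1 (∧E₂ (∧E₂ (# 0))) (≐-refl 1)))
                  (∈-Sing⁺ 3 (∧E₁ (# 0)) (≐-refl 3)))
    (Transitive-∈ (# 4) (Transitive-∈ (# 4) (# 3) (∈-Pr⁺ʳ 0 (∧E₂ (∧E₂ (# 0))) (≐-refl 0)))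
                  (∈-Pr⁺ʳ 2 (∧E₁ (∧E₂ (# 0))) (≐-refl 2))))))))))))

Transitive-OPin : ∀ {Γ T A u v} → Γ ⊢ ∀ⁿ 1 Transitive · T → Γ ⊢ A ∈̇ T → Γ ⊢ ∀ⁿ 3 OPin · u · v · A
  → Γ ⊢ u ∈̇ T ∧̇ v ∈̇ T
Transitive-OPin {T = T} {A} {u} {v} tr A∈T d = weaken-[] closed ⊢· T ⊢· A ⊢· u ⊢· v ⊢$ tr ⊢$ A∈T ⊢$ d
  where
  closed : [] ⊢ ∀ⁿ 4 λ T A u v → Transitive T ⇒' A ∈' T ⇒' OPin u v A ⇒' u ∈' T ∧' v ∈' T
  closed = ∀I (∀I (∀I (∀I (⇒I (⇒I (⇒I (∃E (# 0)
    (Transitive-OP (# 3) (Transitive-∈ (# 3) (# 2) (∧E₂ (# 0))) (∧E₁ (# 0))))))))))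

OP∈𝒫𝒫 : ∀ {Γ T P₁ P₂ p u v} → Γ ⊢ ∀ⁿ 2 IsPowerset · P₁ · T → Γ ⊢ ∀ⁿ 2 IsPowerset · P₂ · P₁
  → Γ ⊢ ∀ⁿ 3 OP · p · u · v → Γ ⊢ u ∈̇ T → Γ ⊢ v ∈̇ T → Γ ⊢ p ∈̇ P₂
OP∈𝒫𝒫 {T = T} {P₁} {P₂} {p} {u} {v} d₁ d₂ d u∈T v∈T =
  weaken-[] closed ⊢· T ⊢· P₁ ⊢· P₂ ⊢· p ⊢· u ⊢· v ⊢$ d₁ ⊢$ d₂ ⊢$ d ⊢$ u∈T ⊢$ v∈T
  where
  closed : [] ⊢ ∀ⁿ 6 λ T P₁ P₂ p u v →
    IsPowerset P₁ T ⇒' IsPowerset P₂ P₁ ⇒' OP p u v ⇒' u ∈' T ⇒' v ∈' T ⇒' p ∈' P₂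
  closed = ∀I (∀I (∀I (∀I (∀I (∀I (⇒I (⇒I (⇒I (⇒I (⇒I (∃E (# 2) (∃E (# 0)
    (⇔E₂ (# 5 ⊢· 4) (∀I (⇒I (⇔E₂ (# 7 ⊢· 0) (∀I (⇒I
    (∨-cases (∈-Pr⁻ 1 (∧E₂ (∧E₂ (# 2))) (# 1))
      (λ e → ∈-substˡ (≐-sym (∈-Sing⁻ 0 (∧E₁ (weaken-∷ (# 2))) (∈-substʳ e (weaken-∷ (# 0)))))
                      (weaken-∷ (# 5)))
      (λ e → ∨-cases (∈-Pr⁻ 0 (∧E₁ (∧E₂ (weaken-∷ (# 2)))) (∈-substʳ e (weaken-∷ (# 0))))
        (λ e₂ → ∈-substˡ (≐-sym e₂) (weaken-∷ (weaken-∷ (# 5))))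
        (λ e₂ → ∈-substˡ (≐-sym e₂) (weaken-∷ (weaken-∷ (# 4))))))))))))))))))))))))

Collapse-pred∈Dom : ∀ {Γ A f x' x} → Γ ⊢ ∀ⁿ 2 Collapse · A · f → Γ ⊢ ∀ⁿ 3 OPin · x' · x · A
  → Γ ⊢ ∀ⁿ 2 InDom · x' · f
Collapse-pred∈Dom {x' = x'} {x} c d =
  ⇔E₂ (∧E₁ (∧E₂ (∧E₂ c)) ⊢· x') (∧I (OPin⇒InUUˡ d) (∃I x (∨I₁ d)))

Collapse-pred-value : ∀ {Γ A f x x' z} → Γ ⊢ ∀ⁿ 2 Collapse · A · f
  → Γ ⊢ ∀ⁿ 3 OPin · x' · x · A → Γ ⊢ ∀ⁿ 3 OPin · x · z · f
  → Γ ⊢ ∀ⁿ 3 (λ f x' z → Ex λ z' → OPin x' z' f ∧' z' ∈' z) · f · x' · z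
Collapse-pred-value {A = A} {f} {x} {x'} {z} c d e =
  weaken-[] closed ⊢· A ⊢· f ⊢· x ⊢· x' ⊢· z ⊢$ c ⊢$ d ⊢$ e
  where
  closed : [] ⊢ ∀ⁿ 5 λ A f x x' z →
    Collapse A f ⇒' OPin x' x A ⇒' OPin x z f ⇒' (Ex λ z' → OPin x' z' f ∧' z' ∈' z)
  closed = ∀I (∀I (∀I (∀I (∀I (⇒I (⇒I (⇒I
    (∃E (∧E₂ (Collapse-pred∈Dom (# 2) (# 1)))
    (∃E (⇔E₂ (∧E₂ (∧E₂ (∧E₂ (# 3))) ⊢· 3 ⊢$ ∧I (OPin⇒InUUˡ (# 1)) (∃I 1 (# 1)) ⊢· 0)
            (∃I 2 (∧I (Collapse-pred∈Dom (# 3) (# 2)) (∧I (# 2) (# 0)))))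
    (∃I 1 (∧I (# 1) (∈-substʳ (∧E₂ (∧E₁ (∧E₂ (# 4))) ⊢· 4 ⊢· 0 ⊢· 2 ⊢$ ∧I (∧E₁ (# 0)) (# 2)) (∧E₂ (# 0))))))))))))))

Collapse-value-pred : ∀ {Γ B k y z z'} → Γ ⊢ ∀ⁿ 2 Collapse · B · k
  → Γ ⊢ ∀ⁿ 3 OPin · y · z · k → Γ ⊢ z' ∈̇ z
  → Γ ⊢ ∀ⁿ 4 (λ B k y z' → Ex λ j → OPin j y B ∧' OPin j z' k) · B · k · y · z'
Collapse-value-pred {B = B} {k} {y} {z} {z'} c d e =
  weaken-[] closed ⊢· B ⊢· k ⊢· y ⊢· z ⊢· z' ⊢$ c ⊢$ d ⊢$ e
  where
  closed : [] ⊢ ∀ⁿ 5 λ B k y z z' →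
    Collapse B k ⇒' OPin y z k ⇒' z' ∈' z ⇒' (Ex λ j → OPin j y B ∧' OPin j z' k)
  closed = ∀I (∀I (∀I (∀I (∀I (⇒I (⇒I (⇒I
    (∃E (⇔E₁ (∧E₂ (∧E₂ (∧E₂ (# 2))) ⊢· 2 ⊢$ ∧I (OPin⇒InUUˡ (# 1)) (∃I 1 (# 1)) ⊢· 0)
            (∃I 1 (∧I (# 1) (# 0))))
    (∃I 0 (∧E₂ (# 0)))))))))))

-- φ̂_A(a) ⊆ ψ̂_B(b), with φ, ψ written f, k
HatIncl : ℕ → ℕ → ℕ → ℕ → ℕ → ℕ → B
HatIncl A a f B b k = All λ j → All λ z →
  OPin j a A ⇒' OPin j z f ⇒' (Ex λ j' → OPin j' b B ∧' OPin j' z k)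

IsHat⇒HatIncl : ∀ {Γ x f A a k B b} → Γ ⊢ ∀ⁿ 4 IsHat · x · f · A · a → Γ ⊢ ∀ⁿ 4 IsHat · x · k · B · b
  → Γ ⊢ ∀ⁿ 6 HatIncl · A · a · f · B · b · k
IsHat⇒HatIncl {x = x} {f} {A} {a} {k} {B} {b} d e =
  weaken-[] closed ⊢· x ⊢· f ⊢· A ⊢· a ⊢· k ⊢· B ⊢· b ⊢$ d ⊢$ e
  where
  closed : [] ⊢ ∀ⁿ 7 λ x f A a k B b → IsHat x f A a ⇒' IsHat x k B b ⇒' HatIncl A a f B b k
  closed = ∀I (∀I (∀I (∀I (∀I (∀I (∀I (⇒I (⇒I (∀I (∀I (⇒I (⇒I
    (∧E₂ (⇔E₁ (# 2 ⊢· 0)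
    (⇔E₂ (# 3 ⊢· 0) (∧I (∧I (OPin⇒InUUʳ (# 0)) (∃I 1 (# 0))) (∃I 1 (∧I (# 1) (# 0)))))))))))))))))))

Linked : ℕ → ℕ → ℕ → ℕ → ℕ → ℕ → B
Linked a b f k i j = (i ≐' a ∧' j ≐' b) ∨' (Ex λ z → OPin i z f ∧' OPin j z k)

Linked-sym : ∀ {Γ a b f k x y} → Γ ⊢ ∀ⁿ 6 Linked · a · b · f · k · x · y
  → Γ ⊢ ∀ⁿ 6 Linked · b · a · k · f · y · x
Linked-sym d = ∨-cases d
  (λ e → ∨I₁ (∧I (∧E₂ e) (∧E₁ e)))
  (λ e → ∨I₂ (∃E e (∃I 0 (∧I (∧E₂ (# 0)) (∧E₁ (# 0))))))

Linked-resp-≐ : ∀ {Γ a b f k i j x y} → Γ ⊢ ∀ⁿ 6 Linked · a · b · f · k · i · j → Γ ⊢ i ≐ x → Γ ⊢ j ≐ y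
  → Γ ⊢ ∀ⁿ 6 Linked · a · b · f · k · x · y
Linked-resp-≐ {a = a} {b} {f} {k} {i} {j} {x} {y} d e₁ e₂ =
  weaken-[] closed ⊢· a ⊢· b ⊢· f ⊢· k ⊢· i ⊢· j ⊢· x ⊢· y ⊢$ d ⊢$ e₁ ⊢$ e₂
  where
  closed : [] ⊢ ∀ⁿ 8 λ a b f k i j x y → Linked a b f k i j ⇒' i ≐' x ⇒' j ≐' y ⇒' Linked a b f k x y
  closed = ∀I (∀I (∀I (∀I (∀I (∀I (∀I (∀I (⇒I (⇒I (⇒I (∨-cases (# 2)
    (λ e → ∨I₁ (∧I (≐-trans (≐-sym (weaken-∷ (# 1))) (∧E₁ e)) (≐-trans (≐-sym (weaken-∷ (# 0))) (∧E₂ e))))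
    (λ e → ∨I₂ (∃E e (∃I 0
      (∧I (OPin-resp-≐ (∧E₁ (# 0)) (# 3) (≐-refl 0)) (OPin-resp-≐ (∧E₂ (# 0)) (# 2) (≐-refl 0)))))))))))))))))

Linked-forth : ∀ {Γ A a f B b k x y x'} → Γ ⊢ ∀ⁿ 2 Collapse · A · f → Γ ⊢ ∀ⁿ 2 Collapse · B · k
  → Γ ⊢ ∀ⁿ 6 HatIncl · A · a · f · B · b · k
  → Γ ⊢ ∀ⁿ 3 OPin · x' · x · A → Γ ⊢ ∀ⁿ 6 Linked · a · b · f · k · x · y
  → Γ ⊢ ∀ⁿ 7 (λ B a b f k y x' → Ex λ y' → OPin y' y B ∧' Linked a b f k x' y') · B · a · b · f · k · y · x'
Linked-forth {A = A} {a} {f} {B} {b} {k} {x} {y} {x'} cA cB h d e =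
  weaken-[] closed ⊢· A ⊢· a ⊢· f ⊢· B ⊢· b ⊢· k ⊢· x ⊢· y ⊢· x' ⊢$ cA ⊢$ cB ⊢$ h ⊢$ d ⊢$ e
  where
  closed : [] ⊢ ∀ⁿ 9 λ A a f B b k x y x' →
    Collapse A f ⇒' Collapse B k ⇒' HatIncl A a f B b k ⇒' OPin x' x A ⇒' Linked a b f k x y ⇒'
    (Ex λ y' → OPin y' y B ∧' Linked a b f k x' y')
  closed = ∀I (∀I (∀I (∀I (∀I (∀I (∀I (∀I (∀I (⇒I (⇒I (⇒I (⇒I (⇒I (∨-cases (# 0)
    (λ _ → ∃E (∧E₂ (Collapse-pred∈Dom (# 5) (# 2)))
           (∃E (# 4 ⊢· 1 ⊢· 0 ⊢$ OPin-resp-≐ (# 3) (≐-refl 1) (∧E₁ (# 1)) ⊢$ # 0)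
           (∃I 0 (∧I (OPin-resp-≐ (∧E₁ (# 0)) (≐-refl 0) (≐-sym (∧E₂ (# 2))))
                     (∨I₂ (∃I 1 (∧I (# 1) (∧E₂ (# 0)))))))))
    (λ e → ∃E e
           (∃E (Collapse-pred-value (# 6) (# 3) (∧E₁ (# 0)))
           (∃E (Collapse-value-pred (# 6) (∧E₂ (# 1)) (∧E₂ (# 0)))
           (∃I 0 (∧I (∧E₁ (# 0)) (∨I₂ (∃I 1 (∧I (∧E₁ (# 1)) (∧E₂ (# 0))))))))))))))))))))))))

LinkedPair : ℕ → ℕ → ℕ → ℕ → ℕ → ℕ → B
LinkedPair p a b f k T = Ex λ i → Ex λ j → OP p i j ∧' i ∈' T ∧' j ∈' T ∧' Linked a b f k i j

LinkedPairs : ℕ → ℕ → ℕ → ℕ → ℕ → ℕ → B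
LinkedPairs a b f k T r = All λ p → p ∈' r ⇔' LinkedPair p a b f k T

-- The parameters of a comprehension formula are numbered from 2 (0 is the element, 1 the
-- bounding set); here the context is P₂ P₁ T k f b a.
LinkedPairs-exists : [] ⊢ ∀ⁿ 5 λ a b f k T → Ex λ r → LinkedPairs a b f k T r
LinkedPairs-exists = ∀I (∀I (∀I (∀I (∀I
  (∃E (axm ax-power ⊢· 0) (∃E (axm ax-power ⊢· 0)
  (∃E (axm (ax-sep (∀ⁿ 6 LinkedPair · 0 · 8 · 7 · 6 · 5 · 4)) ⊢· 0)
  (∃I 0 (∀I (∧I
    (⇒I (∧E₂ (⇔E₁ (# 1 ⊢· 0) (# 0))))
    (⇒I (⇔E₂ (# 1 ⊢· 0) (∧I
      (∃E (# 0) (∃E (# 0)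
        (OP∈𝒫𝒫 (# 5) (# 4) (∧E₁ (# 0)) (∧E₁ (∧E₂ (# 0))) (∧E₁ (∧E₂ (∧E₂ (# 0)))))))
      (# 0))))))))))))))

LinkedPairs⁺ : ∀ {Γ a b f k T r x y} → Γ ⊢ ∀ⁿ 6 LinkedPairs · a · b · f · k · T · r
  → Γ ⊢ x ∈̇ T → Γ ⊢ y ∈̇ T → Γ ⊢ ∀ⁿ 6 Linked · a · b · f · k · x · y → Γ ⊢ ∀ⁿ 3 OPin · x · y · r
LinkedPairs⁺ {a = a} {b} {f} {k} {T} {r} {x} {y} d x∈T y∈T e =
  weaken-[] closed ⊢· a ⊢· b ⊢· f ⊢· k ⊢· T ⊢· r ⊢· x ⊢· y ⊢$ d ⊢$ x∈T ⊢$ y∈T ⊢$ e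
  where
  closed : [] ⊢ ∀ⁿ 8 λ a b f k T r x y →
    LinkedPairs a b f k T r ⇒' x ∈' T ⇒' y ∈' T ⇒' Linked a b f k x y ⇒' OPin x y r
  closed = ∀I (∀I (∀I (∀I (∀I (∀I (∀I (∀I (⇒I (⇒I (⇒I (⇒I
    (∃E (OP-exists 1 0)
    (∃I 0 (∧I (# 0) (⇔E₂ (# 4 ⊢· 0) (∃I 2 (∃I 1 (∧I (# 0) (∧I (# 3) (∧I (# 2) (# 1)))))))))))))))))))))

LinkedPairs⁻ : ∀ {Γ a b f k T r x y} → Γ ⊢ ∀ⁿ 6 LinkedPairs · a · b · f · k · T · r
  → Γ ⊢ ∀ⁿ 3 OPin · x · y · r → Γ ⊢ ∀ⁿ 6 Linked · a · b · f · k · x · y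
LinkedPairs⁻ {a = a} {b} {f} {k} {T} {r} {x} {y} d e =
  weaken-[] closed ⊢· a ⊢· b ⊢· f ⊢· k ⊢· T ⊢· r ⊢· x ⊢· y ⊢$ d ⊢$ e
  where
  closed : [] ⊢ ∀ⁿ 8 λ a b f k T r x y → LinkedPairs a b f k T r ⇒' OPin x y r ⇒' Linked a b f k x y
  closed = ∀I (∀I (∀I (∀I (∀I (∀I (∀I (∀I (⇒I (⇒I
    (∃E (# 0) (∃E (⇔E₁ (# 2 ⊢· 0) (∧E₂ (# 0))) (∃E (# 0)
    (have (OP-injective (∧E₁ (# 2)) (∧E₁ (# 0)))
    (Linked-resp-≐ (∧E₂ (∧E₂ (∧E₂ (# 1)))) (≐-sym (∧E₁ (# 0))) (≐-sym (∧E₂ (# 0)))))))))))))))))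

Forth Back : ℕ → ℕ → ℕ → B
Forth A B r = All λ x → All λ x' → All λ y →
  (OPin x' x A ∧' OPin x y r) ⇒' (Ex λ y' → OPin y' y B ∧' OPin x' y' r)
Back A B r = All λ y → All λ y' → All λ x →
  (OPin y' y B ∧' OPin x y r) ⇒' (Ex λ x' → OPin x' x A ∧' OPin x' y' r)

LinkedPairs-forth : [] ⊢ ∀ⁿ 8 λ A a f B b k T r →
  Collapse A f ⇒' Collapse B k ⇒' HatIncl A a f B b k ⇒' A ∈' T ⇒' B ∈' T ⇒' Transitive T ⇒'
  LinkedPairs a b f k T r ⇒' Forth A B r
LinkedPairs-forth = ∀I (∀I (∀I (∀I (∀I (∀I (∀I (∀I (⇒I (⇒I (⇒I (⇒I (⇒I (⇒I (⇒I
  (∀I (∀I (∀I (⇒I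
  (∃E (Linked-forth (# 7) (# 6) (# 5) (∧E₁ (# 0)) (LinkedPairs⁻ (# 1) (∧E₂ (# 0))))
  (∃I 0 (∧I (∧E₁ (# 0))
    (LinkedPairs⁺ (# 2) (∧E₁ (Transitive-OPin (# 3) (# 5) (∧E₁ (# 1))))
                        (∧E₁ (Transitive-OPin (# 3) (# 4) (∧E₁ (# 0)))) (∧E₂ (# 0))))))))))))))))))))))))

LinkedPairs-back : [] ⊢ ∀ⁿ 8 λ A a f B b k T r →
  Collapse A f ⇒' Collapse B k ⇒' HatIncl B b k A a f ⇒' A ∈' T ⇒' B ∈' T ⇒' Transitive T ⇒'
  LinkedPairs a b f k T r ⇒' Back A B r
LinkedPairs-back = ∀I (∀I (∀I (∀I (∀I (∀I (∀I (∀I (⇒I (⇒I (⇒I (⇒I (⇒I (⇒I (⇒I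
  (∀I (∀I (∀I (⇒I
  (∃E (Linked-forth (# 6) (# 7) (# 5) (∧E₁ (# 0)) (Linked-sym (LinkedPairs⁻ (# 1) (∧E₂ (# 0)))))
  (∃I 0 (∧I (∧E₁ (# 0))
    (LinkedPairs⁺ (# 2) (∧E₁ (Transitive-OPin (# 3) (# 5) (∧E₁ (# 0))))
                        (∧E₁ (Transitive-OPin (# 3) (# 4) (∧E₁ (# 1)))) (Linked-sym (∧E₂ (# 0)))))))))))))))))))))))))

Reifies : ℕ → ℕ → ℕ → ℕ → ℕ → B
Reifies g x A a f = OP g A a ∧' Collapse A f ∧' IsHat x f A a

reifications-bisimilar : [] ⊢ ∀ⁿ 9 λ x g h A a f B b k →
  Reifies g x A a f ⇒' Reifies h x B b k ⇒' Bisim g h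
reifications-bisimilar = ∀I (∀I (∀I (∀I (∀I (∀I (∀I (∀I (∀I (⇒I (⇒I
  (∃E (axm ax-pair ⊢· 7 ⊢· 6) (∃E (axm ax-tc ⊢· 0)
  (have (Transitive-OP (∧E₂ (# 0)) (∧E₁ (# 0) ⊢· 9 ⊢$ ∈-Pr⁺ˡ 9 (# 1) (≐-refl 9)) (∧E₁ (# 3)))
  (have (Transitive-OP (∧E₂ (# 1)) (∧E₁ (# 1) ⊢· 8 ⊢$ ∈-Pr⁺ʳ 8 (# 2) (≐-refl 8)) (∧E₁ (# 3)))
  (∃E (weaken-[] LinkedPairs-exists ⊢· 6 ⊢· 3 ⊢· 5 ⊢· 2 ⊢· 0)
  (∃I 8 (∃I 7 (∃I 5 (∃I 4 (∃I 0
    (∧I (∧E₁ (∧E₁ (∧E₂ (# 6)))) (∧I (∧E₁ (∧E₁ (∧E₂ (# 5)))) (∧I (∧E₁ (# 6)) (∧I (∧E₁ (# 5))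
    (∧I (LinkedPairs⁺ (# 0) (∧E₂ (# 2)) (∧E₂ (# 1)) (∨I₁ (∧I (≐-refl 7) (≐-refl 4))))
    (∧I (weaken-[] LinkedPairs-forth ⊢· 8 ⊢· 7 ⊢· 6 ⊢· 5 ⊢· 4 ⊢· 3 ⊢· 1 ⊢· 0
          ⊢$ ∧E₁ (∧E₂ (# 6)) ⊢$ ∧E₁ (∧E₂ (# 5)) ⊢$ IsHat⇒HatIncl (∧E₂ (∧E₂ (# 6))) (∧E₂ (∧E₂ (# 5)))
          ⊢$ ∧E₁ (# 2) ⊢$ ∧E₁ (# 1) ⊢$ ∧E₂ (# 3) ⊢$ # 0)
       (weaken-[] LinkedPairs-back ⊢· 8 ⊢· 7 ⊢· 6 ⊢· 5 ⊢· 4 ⊢· 3 ⊢· 1 ⊢· 0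
          ⊢$ ∧E₁ (∧E₂ (# 6)) ⊢$ ∧E₁ (∧E₂ (# 5)) ⊢$ IsHat⇒HatIncl (∧E₂ (∧E₂ (# 5))) (∧E₂ (∧E₂ (# 6)))
          ⊢$ ∧E₁ (# 2) ⊢$ ∧E₁ (# 1) ⊢$ ∧E₂ (# 3) ⊢$ # 0)))))))))))))))))))))))))))

proposition6 : [] ⊢ ReifUnique
proposition6 = ∀I (∀I (∀I (⇒I
  (∃E (∧E₁ (# 0)) (∃E (# 0) (∃E (# 0)
  (∃E (∧E₂ (# 3)) (∃E (# 0) (∃E (# 0)
  (weaken-[] reifications-bisimilar ⊢· 8 ⊢· 7 ⊢· 6 ⊢· 5 ⊢· 4 ⊢· 3 ⊢· 2 ⊢· 1 ⊢· 0 ⊢$ # 3 ⊢$ # 0))))))))))
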